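{- For every $n\ge 1$, the complete complex $K_n$ satisfies ${\rm Dim}^+(K_n)=\frac n2=\frac{{\rm dim}^+(K_n)}{2}$. Moreover, if a finite abstract simplicial complex $G$ satisfies ${\rm Dim}^+(G)={\rm dim}^+(G)/2$, then $G$ is a complete complex $K_n$ (the set of all non-empty subsets of its vertex set).
   Context: A finite abstract simplicial complex $G$ is a finite set of non-empty finite sets closed under taking non-empty subsets; $|G|$ denotes the number of its members. $K_n$ is the complex of all non-empty subsets of an $n$-element set. The average simplex cardinality is ${\rm Dim}^+(G)=\frac{1}{|G|+1}\sum_{x\in G}|x|$. Inductive dimension: for a finite set $H$ of non-empty finite sets and $x\in H$, the unit sphere is $S_H(x)=\{y\in H: y\ne x,\ y\subset x \text{ or } x\subset y\}$; define recursively ${\rm dim}(\emptyset)=-1$ for the empty set of sets and ${\rm dim}(H)=1+\frac{1}{|H|}\sum_{x\in H}{\rm dim}(S_H(x))$ otherwise. The augmented inductive dimension is ${\rm dim}^+(H)={\rm dim}(H)+1$. -}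

module Defs where

open import Data.Nat as ℕ using (ℕ; zero; suc)
open import Data.Integer using (+_)
open import Data.Rational using (ℚ; _+_; _*_; _/_; -_; 0ℚ; 1ℚ)
open import Data.Bool using (Bool; true; false)
open import Data.Bool.Properties using () renaming (_≟_ to _≟B_)
open import Data.Fin using (Fin)
open import Data.Fin.Subset using (Subset; _⊆_; _∈_; ∣_∣; Nonempty)
open import Data.Fin.Subset.Properties using (_⊆?_)
open import Data.Vec.Properties using (≡-dec)
open import Data.List using (List; []; _∷_; length; map; filter; foldr)
open import Data.List.Relation.Unary.Unique.Propositional using (Unique)
import Data.List.Membership.Propositional as LM
open import Data.Product using (_×_; ∃; _,_)
open import Data.Sum using (_⊎_)
open import Relation.Nullary using (¬_; Dec; yes; no)
open import Relation.Nullary.Decidable using (_×-dec_; _⊎-dec_; ¬?)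
open import Relation.Binary.PropositionalEquality using (_≡_; _≢_)

_≟S_ : ∀ {n} (x y : Subset n) → Dec (x ≡ y)
_≟S_ = ≡-dec _≟B_

-- A finite set of non-empty finite sets over the vertex universe Fin n
-- is represented by a duplicate-free list of subsets of Fin n.

record IsComplex {n : ℕ} (G : List (Subset n)) : Set where
  field
    unique   : Unique G
    nonempty : ∀ {x} → x LM.∈ G → Nonempty x
    closed   : ∀ {x y} → x LM.∈ G → Nonempty y → y ⊆ x → y LM.∈ G

sumℚ : List ℚ → ℚ
sumℚ = foldr _+_ 0ℚ

sumℕ : List ℕ → ℕ
sumℕ = foldr ℕ._+_ 0

Dim⁺ : ∀ {n} → List (Subset n) → ℚ
Dim⁺ G = + sumℕ (map ∣_∣ G) / suc (length G)

sphere : ∀ {n} → List (Subset n) → Subset n → List (Subset n)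
sphere H x = filter (λ y → ¬? (y ≟S x) ×-dec ((y ⊆? x) ⊎-dec (x ⊆? y))) H

-- Inductive dimension with fuel; the fuel only ensures termination:
-- for a duplicate-free H, every sphere S_H(x) with x ∈ H has fewer
-- members than H, so fuel = |H| suffices (see dim below).
-- dim(∅) = -1, dim(H) = 1 + (1/|H|) Σ_{x∈H} dim(S_H(x)).
dimF : ∀ {n} → ℕ → List (Subset n) → ℚ
dimF zero    _        = - 1ℚ
dimF (suc k) []       = - 1ℚ
dimF (suc k) (h ∷ hs) =
  1ℚ + (+ 1 / suc (length hs)) * sumℚ (map (λ x → dimF k (sphere (h ∷ hs) x)) (h ∷ hs))

dim : ∀ {n} → List (Subset n) → ℚ
dim H = dimF (length H) H

dim⁺ : ∀ {n} → List (Subset n) → ℚ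
dim⁺ H = dim H + 1ℚ

IsVertex : ∀ {n} → List (Subset n) → Fin n → Set
IsVertex G i = ∃ λ y → y LM.∈ G × i ∈ y

IsCompleteOnVertices : ∀ {n} → List (Subset n) → Set
IsCompleteOnVertices {n} G =
  ∀ (x : Subset n) → Nonempty x → (∀ i → i ∈ x → IsVertex G i) → x LM.∈ G

IsKn : (n : ℕ) → List (Subset n) → Set
IsKn n G = Unique G × (∀ (x : Subset n) → (x LM.∈ G → Nonempty x) × (Nonempty x → x LM.∈ G))

module Submission where

-- For K_n, the face sizes add up to n 2ⁿ⁻¹ over 2ⁿ - 1 faces, so Dim⁺ = n/2. For dim⁺, note that the unit
-- sphere of x contains no other set of size |x|, as comparable sets of equal size coincide; by induction,
-- dim⁺ H is at most the number of sizes occurring in H. In K_n equality holds: the unit sphere of a face in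
-- the link of a chain C is the link of the longer chain, and every size missing from C is realised in that
-- link, so by induction the dimension of the link is at least the number of missing sizes.
--
-- Conversely, let G have m faces and let deg x count the vertices v ∉ x with x ∪ {v} ∈ G. The sphere of x
-- only contains sizes in [1, |x| + deg x] ∖ {|x|}, so dim⁺ G ≤ (∑|x| + ∑ deg x) / m, and Dim⁺ = dim⁺/2 turns
-- this into 2m ∑|x| ≤ (m + 1)(∑|x| + ∑ deg x). Both sums split over the vertices: v lies in N faces and
-- extends a of the m - N faces missing it, where a < N because x ↦ x ∪ {v} is injective and misses {v}.
-- Then (m + 1)(N + a) ≤ 2mN, with equality only when every face missing v extends by v. Hence all vertex
-- terms are balanced, G is closed under adding vertices, and so contains every non-empty set of vertices.

open import Defs

open import Algebra.Bundles using (CommutativeMonoid)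
open import Algebra.Properties.CommutativeSemigroup using () renaming (interchange to +-interchange)
open import Data.Bool using (if_then_else_)
open import Data.Empty using (⊥-elim)
open import Data.Fin as Fin using (Fin)
open import Data.Fin.Subset using (Subset; inside; outside; _⊆_; _∈_; _∉_; ∣_∣; Nonempty; ⊥; ⊤; ⁅_⁆; _∪_; _─_; _-_)
open import Data.Fin.Subset.Properties using (_∈?_; _⊆?_; nonempty?; Empty-unique; ∉⊥; ∣⊥∣≡0; ∣⊤∣≡n; ∣⁅x⁆∣≡1; ∣p∣≤n;
  x∈⁅x⁆; x∈⁅y⁆⇒x≡y; x∈p∪q⁺; x∈p∪q⁻; p─q⊆p; x∈p∧x≢y⇒x∈p-y; x∈p⇒∣p-x∣<∣p∣; p⊆q⇒∣p∣≤∣q∣;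
  drop-∷-⊆; s⊆s; out⊆; ⊆-refl; ⊆-trans; ⊆-antisym; ⊆-min; ⊆-max)
open import Data.Integer as ℤ using (+_)
import Data.Integer.Properties as ℤ
open import Data.List using (List; []; _∷_; length; map; filter; _++_; applyUpTo; allFin)
open import Data.List.Properties
  using (map-tabulate; map-cong; map-∘; map-++; length-++; length-map; length-applyUpTo; filter-notAll)
open import Data.List.Membership.Propositional using () renaming (_∈_ to _∈ₗ_)
open import Data.List.Membership.Propositional.Properties
  using (∈-∃++; ∈-++⁻; ∈-++⁺ˡ; ∈-++⁺ʳ; ∈-filter⁺; ∈-filter⁻; ∈-map⁺; ∈-map⁻; ∈-applyUpTo⁺; ∈-applyUpTo⁻; ∈-allFin)
open import Data.List.Membership.Propositional.Properties.WithK using (unique∧set⇒bag)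
import Data.List.Membership.DecPropositional as DecMembership
open import Data.List.Relation.Binary.BagAndSetEquality using (∼bag⇒↭)
open import Data.List.Relation.Binary.Permutation.Propositional using (_↭_)
import Data.List.Relation.Binary.Permutation.Propositional.Properties as ↭
open import Data.List.Relation.Unary.All as All using (All; []; _∷_)
open import Data.List.Relation.Unary.AllPairs using (AllPairs; []; _∷_)
open import Data.List.Relation.Unary.Any as Any using (here; there)
open import Data.List.Relation.Unary.Unique.Propositional using (Unique)
import Data.List.Relation.Unary.Unique.Propositional.Properties as Unique
open import Data.Nat as ℕ using (ℕ; zero; suc; z≤n; s≤s; _≥_; _^_)
open import Data.Nat.ListAction.Properties using (sum-++; sum-↭)
import Data.Nat.Properties as ℕ
open import Data.Nat.Solver using () renaming (module +-*-Solver to ℕ-Solver)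
open import Data.Product using (∃; _×_; _,_; proj₁; proj₂)
open import Data.Rational as ℚ using (ℚ; _+_; _*_; _/_; 1ℚ; ½)
import Data.Rational.Properties as ℚ
open import Data.Rational.Unnormalised as ℚᵘ using (mkℚᵘ; *≡*; *≤*)
import Data.Rational.Unnormalised.Properties as ℚᵘ
open import Data.Sum using (_⊎_; inj₁; inj₂)
open import Data.Vec using ([]; _∷_; here; there)
import Data.Vec.Properties as Vec
open import Function using (_∘_; id)
open import Function.Bundles using (mk⇔)
open import Relation.Binary.Definitions using (Tri; tri<; tri≈; tri>)
open import Relation.Binary.PropositionalEquality hiding ([_])
open import Relation.Nullary using (¬_; Dec; yes; no; does; contradiction)
open import Relation.Nullary.Decidable using (¬?; _×-dec_; _⊎-dec_)

fromℕ : ℕ → ℚ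
fromℕ n = + n / 1

private
  toℚᵘ-/ : ∀ a k → ℚ.toℚᵘ (+ a / suc k) ℚᵘ.≃ mkℚᵘ (+ a) k
  toℚᵘ-/ a k = ℚ.toℚᵘ-fromℚᵘ (mkℚᵘ (+ a) k)

  pos-cross : ∀ {a k b l} → a ℕ.* suc l ≡ b ℕ.* suc k → + a ℤ.* + suc l ≡ + b ℤ.* + suc k
  pos-cross {a} {k} {b} {l} eq = trans (sym (ℤ.pos-* a (suc l))) (trans (cong +_ eq) (ℤ.pos-* b (suc k)))

/-cross-≡ : ∀ {a k b l} → a ℕ.* suc l ≡ b ℕ.* suc k → + a / suc k ≡ + b / suc l
/-cross-≡ {a} {k} {b} {l} eq = ℚ.fromℚᵘ-cong {mkℚᵘ (+ a) k} {mkℚᵘ (+ b) l} (*≡* (pos-cross {a} {k} {b} {l} eq))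

/-cross-≤ : ∀ {a k b l} → a ℕ.* suc l ℕ.≤ b ℕ.* suc k → + a / suc k ℚ.≤ + b / suc l
/-cross-≤ {a} {k} {b} {l} le = ℚ.toℚᵘ-cancel-≤
  (ℚᵘ.≤-respʳ-≃ (ℚᵘ.≃-sym (toℚᵘ-/ b l)) (ℚᵘ.≤-respˡ-≃ (ℚᵘ.≃-sym (toℚᵘ-/ a k))
    (*≤* (subst₂ ℤ._≤_ (ℤ.pos-* a (suc l)) (ℤ.pos-* b (suc k)) (ℤ.+≤+ le)))))

/-cross-≤⁻ : ∀ {a k b l} → + a / suc k ℚ.≤ + b / suc l → a ℕ.* suc l ℕ.≤ b ℕ.* suc k
/-cross-≤⁻ {a} {k} {b} {l} le with ℚᵘ.≤-respʳ-≃ (toℚᵘ-/ b l) (ℚᵘ.≤-respˡ-≃ (toℚᵘ-/ a k) (ℚ.toℚᵘ-mono-≤ le))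
... | *≤* le′ = ℤ.drop‿+≤+ (subst₂ ℤ._≤_ (sym (ℤ.pos-* a (suc l))) (sym (ℤ.pos-* b (suc k))) le′)

/-*-/ : ∀ a k b l → (+ a / suc k) * (+ b / suc l) ≡ + (a ℕ.* b) / (suc k ℕ.* suc l)
/-*-/ a k b l = ℚ.toℚᵘ-injective (begin-equality
  ℚ.toℚᵘ ((+ a / suc k) * (+ b / suc l))          ≃⟨ ℚ.toℚᵘ-homo-* (+ a / suc k) (+ b / suc l) ⟩
  ℚ.toℚᵘ (+ a / suc k) ℚᵘ.* ℚ.toℚᵘ (+ b / suc l) ≃⟨ ℚᵘ.*-cong (toℚᵘ-/ a k) (toℚᵘ-/ b l) ⟩
  mkℚᵘ (+ a ℤ.* + b) (l ℕ.+ k ℕ.* suc l)           ≃⟨ *≡* (cong (ℤ._* + suc (l ℕ.+ k ℕ.* suc l)) (sym (ℤ.pos-* a b))) ⟩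
  mkℚᵘ (+ (a ℕ.* b)) (l ℕ.+ k ℕ.* suc l)           ≃⟨ toℚᵘ-/ (a ℕ.* b) (l ℕ.+ k ℕ.* suc l) ⟨
  ℚ.toℚᵘ (+ (a ℕ.* b) / (suc k ℕ.* suc l))         ∎)
  where open ℚᵘ.≤-Reasoning

/-*-fromℕ : ∀ a k b → (+ a / suc k) * fromℕ b ≡ + (a ℕ.* b) / suc k
/-*-fromℕ a k b = trans (/-*-/ a k b 0) (ℚ./-cong {+ (a ℕ.* b)} {suc k ℕ.* 1} refl (ℕ.*-identityʳ (suc k)))

fromℕ-+ : ∀ a b → fromℕ (a ℕ.+ b) ≡ fromℕ a + fromℕ b
fromℕ-+ a b = ℚ.toℚᵘ-injective (ℚᵘ.≃-sym (ℚᵘ.≃-trans (ℚ.toℚᵘ-homo-+ (fromℕ a) (fromℕ b))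
  (ℚᵘ.≃-trans (ℚᵘ.+-cong (toℚᵘ-/ a 0) (toℚᵘ-/ b 0)) (ℚᵘ.≃-trans (*≡* numerators) (ℚᵘ.≃-sym (toℚᵘ-/ (a ℕ.+ b) 0))))))
  where
  numerators : (+ a ℤ.* + 1 ℤ.+ + b ℤ.* + 1) ℤ.* + 1 ≡ + (a ℕ.+ b) ℤ.* + 1
  numerators = cong (ℤ._* + 1) (trans (cong₂ ℤ._+_ (ℤ.*-identityʳ (+ a)) (ℤ.*-identityʳ (+ b))) (sym (ℤ.pos-+ a b)))

fromℕ-suc : ∀ a → fromℕ (suc a) ≡ fromℕ a + 1ℚ
fromℕ-suc a = trans (fromℕ-+ 1 a) (ℚ.+-comm 1ℚ (fromℕ a))

fromℕ-mono-≤ : ∀ {a b} → a ℕ.≤ b → fromℕ a ℚ.≤ fromℕ b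
fromℕ-mono-≤ {a} {b} a≤b = /-cross-≤ {a} {0} {b} {0} (ℕ.*-monoˡ-≤ 1 a≤b)

1/suc*fromℕ-suc : ∀ k → (+ 1 / suc k) * fromℕ (suc k) ≡ 1ℚ
1/suc*fromℕ-suc k = trans (/-*-fromℕ 1 k (suc k)) (/-cross-≡ {1 ℕ.* suc k} {k} {1} {0} (ℕ.*-identityʳ (1 ℕ.* suc k)))

fromℕ*½ : ∀ n → fromℕ n * ½ ≡ + n / 2
fromℕ*½ n = trans (ℚ.*-comm (fromℕ n) ½) (trans (/-*-fromℕ 1 1 n) (ℚ./-cong {+ (1 ℕ.* n)} {2} (cong +_ (ℕ.*-identityˡ n)) refl))

half-/-cross-≤ : ∀ {f m c l} {y : ℚ} → + f / suc m ≡ y * ½ → y ℚ.≤ + c / suc l → f ℕ.* 2 ℕ.* suc l ℕ.≤ c ℕ.* suc m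
half-/-cross-≤ {f} {m} {c} {l} {y} f/m≡y/2 y≤c/l = /-cross-≤⁻ {f ℕ.* 2} {m} {c} {l} (subst (ℚ._≤ + c / suc l) y≡2f/m y≤c/l)
  where
  open ≡-Reasoning
  y≡2f/m : y ≡ + (f ℕ.* 2) / suc m
  y≡2f/m = begin
    y                       ≡⟨ ℚ.*-identityʳ y ⟨
    y * 1ℚ                  ≡⟨ cong (y *_) (1/suc*fromℕ-suc 1) ⟨
    y * (½ * fromℕ 2)       ≡⟨ ℚ.*-assoc y ½ (fromℕ 2) ⟨
    y * ½ * fromℕ 2         ≡⟨ cong (_* fromℕ 2) f/m≡y/2 ⟨
    + f / suc m * fromℕ 2   ≡⟨ /-*-fromℕ f m 2 ⟩
    + (f ℕ.* 2) / suc m     ∎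

𝟙 : ∀ {P : Set} → Dec P → ℕ
𝟙 d = if does d then 1 else 0

∑ : ∀ {A : Set} → List A → (A → ℕ) → ℕ
∑ L g = sumℕ (map g L)

module _ {A : Set} where

  ∑-cong : ∀ L {g h : A → ℕ} → (∀ x → g x ≡ h x) → ∑ L g ≡ ∑ L h
  ∑-cong L g≗h = cong sumℕ (map-cong g≗h L)

  ∑-+ : ∀ L (g h : A → ℕ) → ∑ L (λ x → g x ℕ.+ h x) ≡ ∑ L g ℕ.+ ∑ L h
  ∑-+ []      g h = refl
  ∑-+ (x ∷ L) g h = trans (cong (g x ℕ.+ h x ℕ.+_) (∑-+ L g h)) (+-interchange ℕ.+-commutativeSemigroup (g x) (h x) _ _)

  ∑-*ʳ : ∀ L (g : A → ℕ) c → ∑ L (λ x → g x ℕ.* c) ≡ ∑ L g ℕ.* c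
  ∑-*ʳ []      g c = refl
  ∑-*ʳ (x ∷ L) g c = trans (cong (g x ℕ.* c ℕ.+_) (∑-*ʳ L g c)) (sym (ℕ.*-distribʳ-+ c (g x) _))

  ∑-map : ∀ {B : Set} L (f : A → B) (g : B → ℕ) → ∑ (map f L) g ≡ ∑ L (g ∘ f)
  ∑-map L f g = cong sumℕ (sym (map-∘ L))

  ∑-++ : ∀ L M (g : A → ℕ) → ∑ (L ++ M) g ≡ ∑ L g ℕ.+ ∑ M g
  ∑-++ L M g = trans (cong sumℕ (map-++ g L M)) (sum-++ (map g L) (map g M))

  ∑-1 : ∀ (L : List A) → ∑ L (λ _ → 1) ≡ length L
  ∑-1 []      = refl
  ∑-1 (x ∷ L) = cong suc (∑-1 L)

  ∑-mono-≤ : ∀ L {g h : A → ℕ} → (∀ {x} → x ∈ₗ L → g x ℕ.≤ h x) → ∑ L g ℕ.≤ ∑ L h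
  ∑-mono-≤ []      g≤h = z≤n
  ∑-mono-≤ (x ∷ L) g≤h = ℕ.+-mono-≤ (g≤h (here refl)) (∑-mono-≤ L (g≤h ∘ there))

  ∑-mono-≤-equality : ∀ L {g h : A → ℕ} → (∀ {x} → x ∈ₗ L → g x ℕ.≤ h x) → ∑ L h ℕ.≤ ∑ L g →
                      ∀ {x} → x ∈ₗ L → g x ≡ h x
  ∑-mono-≤-equality (y ∷ L) {g} {h} g≤h ∑h≤∑g (here refl) = ℕ.≤-antisym (g≤h (here refl))
    (ℕ.+-cancelʳ-≤ (∑ L h) (h y) (g y) (ℕ.≤-trans ∑h≤∑g (ℕ.+-monoʳ-≤ (g y) (∑-mono-≤ L (g≤h ∘ there)))))
  ∑-mono-≤-equality (y ∷ L) {g} {h} g≤h ∑h≤∑g (there x∈L) = ∑-mono-≤-equality L (g≤h ∘ there)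
    (ℕ.+-cancelˡ-≤ (h y) _ _ (ℕ.≤-trans ∑h≤∑g (ℕ.+-monoˡ-≤ (∑ L g) (g≤h (here refl))))) x∈L

  ∑-≥-term : ∀ L (g : A → ℕ) {x} → x ∈ₗ L → g x ℕ.≤ ∑ L g
  ∑-≥-term (y ∷ L) g (here refl) = ℕ.m≤m+n (g y) _
  ∑-≥-term (y ∷ L) g (there x∈L) = ℕ.≤-trans (∑-≥-term L g x∈L) (ℕ.m≤n+m _ (g y))

  ∑-zero : ∀ L (g : A → ℕ) → (∀ {x} → x ∈ₗ L → g x ≡ 0) → ∑ L g ≡ 0
  ∑-zero []      g g≡0 = refl
  ∑-zero (x ∷ L) g g≡0 = cong₂ ℕ._+_ (g≡0 (here refl)) (∑-zero L g (g≡0 ∘ there))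

  ∑-𝟙 : ∀ {P : A → Set} (P? : ∀ x → Dec (P x)) L → ∑ L (λ x → 𝟙 (P? x)) ≡ length (filter P? L)
  ∑-𝟙 P? []      = refl
  ∑-𝟙 P? (x ∷ L) with P? x
  ... | yes _ = cong suc (∑-𝟙 P? L)
  ... | no  _ = ∑-𝟙 P? L

  length-mono-⊆ : ∀ {xs ys : List A} → Unique xs → (∀ {x} → x ∈ₗ xs → x ∈ₗ ys) → length xs ℕ.≤ length ys
  length-mono-⊆ {[]}     _           _     = z≤n
  length-mono-⊆ {x ∷ xs} (x∉xs ∷ xs!) xs⊆ys with ∈-∃++ (xs⊆ys (here refl))
  ... | ys₁ , ys₂ , refl = begin
    suc (length xs)             ≤⟨ s≤s (length-mono-⊆ xs! xs⊆ys₁++ys₂) ⟩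
    suc (length (ys₁ ++ ys₂))   ≡⟨ cong suc (length-++ ys₁) ⟩
    suc (length ys₁ ℕ.+ length ys₂) ≡⟨ ℕ.+-suc (length ys₁) _ ⟨
    length ys₁ ℕ.+ length (x ∷ ys₂) ≡⟨ length-++ ys₁ ⟨
    length (ys₁ ++ x ∷ ys₂)     ∎
    where
    open ℕ.≤-Reasoning
    xs⊆ys₁++ys₂ : ∀ {y} → y ∈ₗ xs → y ∈ₗ ys₁ ++ ys₂
    xs⊆ys₁++ys₂ {y} y∈xs with ∈-++⁻ ys₁ (xs⊆ys (there y∈xs))
    ... | inj₁ y∈ys₁           = ∈-++⁺ˡ y∈ys₁
    ... | inj₂ (here refl)     = ⊥-elim (All.lookup x∉xs y∈xs refl)
    ... | inj₂ (there y∈ys₂)   = ∈-++⁺ʳ ys₁ y∈ys₂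

map⁺-injectiveOn : ∀ {A B : Set} {f : A → B} {xs : List A} → (∀ {x y} → x ∈ₗ xs → y ∈ₗ xs → f x ≡ f y → x ≡ y) →
                   Unique xs → Unique (map f xs)
map⁺-injectiveOn {xs = []}     _        []           = []
map⁺-injectiveOn {f = f} {x ∷ xs} injective (x∉xs ∷ xs!) =
  All.tabulate fx∉fxs ∷ map⁺-injectiveOn (λ x∈ y∈ → injective (there x∈) (there y∈)) xs!
  where
  fx∉fxs : ∀ {z} → z ∈ₗ map f xs → f x ≢ z
  fx∉fxs z∈ fx≡z with y , y∈xs , refl ← ∈-map⁻ f z∈ = All.lookup x∉xs y∈xs (injective (here refl) (there y∈xs) fx≡z)

∑-comm : ∀ {A B : Set} (L : List A) (V : List B) (g : A → B → ℕ) → ∑ L (λ x → ∑ V (g x)) ≡ ∑ V (λ v → ∑ L (λ x → g x v))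
∑-comm []      V g = sym (∑-zero V (λ _ → 0) (λ _ → refl))
∑-comm (x ∷ L) V g = trans (cong (∑ V (g x) ℕ.+_) (∑-comm L V g)) (sym (∑-+ V (g x) _))

module _ {A : Set} where

  sumℚ-mono-≤ : ∀ L {g h : A → ℚ} → (∀ {x} → x ∈ₗ L → g x ℚ.≤ h x) → sumℚ (map g L) ℚ.≤ sumℚ (map h L)
  sumℚ-mono-≤ []      g≤h = ℚ.≤-refl
  sumℚ-mono-≤ (x ∷ L) g≤h = ℚ.+-mono-≤ (g≤h (here refl)) (sumℚ-mono-≤ L (g≤h ∘ there))

  sumℚ-+ : ∀ L (g h : A → ℚ) → sumℚ (map (λ x → g x + h x) L) ≡ sumℚ (map g L) + sumℚ (map h L)
  sumℚ-+ []      g h = refl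
  sumℚ-+ (x ∷ L) g h = trans (cong (_+_ (g x + h x)) (sumℚ-+ L g h)) (+-interchange (CommutativeMonoid.commutativeSemigroup ℚ.+-0-commutativeMonoid) (g x) (h x) _ _)

  sumℚ-fromℕ : ∀ L (g : A → ℕ) → sumℚ (map (fromℕ ∘ g) L) ≡ fromℕ (∑ L g)
  sumℚ-fromℕ []      g = refl
  sumℚ-fromℕ (x ∷ L) g = trans (cong (_+_ (fromℕ (g x))) (sumℚ-fromℕ L g)) (sym (fromℕ-+ (g x) _))

  sumℚ-const : ∀ (L : List A) (c : ℚ) → sumℚ (map (λ _ → c) L) ≡ fromℕ (length L) * c
  sumℚ-const []      c = sym (ℚ.*-zeroˡ c)
  sumℚ-const (x ∷ L) c = begin
    c + sumℚ (map (λ _ → c) L)      ≡⟨ cong (_+_ c) (sumℚ-const L c) ⟩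
    c + fromℕ (length L) * c        ≡⟨ cong (_+ fromℕ (length L) * c) (ℚ.*-identityˡ c) ⟨
    1ℚ * c + fromℕ (length L) * c   ≡⟨ ℚ.*-distribʳ-+ c 1ℚ (fromℕ (length L)) ⟨
    (1ℚ + fromℕ (length L)) * c     ≡⟨ cong (_* c) (fromℕ-+ 1 (length L)) ⟨
    fromℕ (suc (length L)) * c      ∎
    where open ≡-Reasoning

  mean : (A → ℚ) → A → List A → ℚ
  mean g x xs = + 1 / suc (length xs) * sumℚ (map g (x ∷ xs))

  mean-mono-≤ : ∀ {g h : A → ℚ} x xs → (∀ {y} → y ∈ₗ x ∷ xs → g y ℚ.≤ h y) → mean g x xs ℚ.≤ mean h x xs
  mean-mono-≤ x xs g≤h =
    ℚ.*-monoˡ-≤-nonNeg (+ 1 / suc (length xs)) {{ℚ.normalize-nonNeg 1 (suc (length xs))}} (sumℚ-mono-≤ (x ∷ xs) g≤h)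

  mean-const : ∀ c x xs → mean (λ _ → c) x xs ≡ c
  mean-const c x xs = begin
    + 1 / suc k * sumℚ (map (λ _ → c) (x ∷ xs)) ≡⟨ cong (+ 1 / suc k *_) (sumℚ-const (x ∷ xs) c) ⟩
    + 1 / suc k * (fromℕ (suc k) * c)            ≡⟨ ℚ.*-assoc (+ 1 / suc k) (fromℕ (suc k)) c ⟨
    + 1 / suc k * fromℕ (suc k) * c              ≡⟨ cong (_* c) (1/suc*fromℕ-suc k) ⟩
    1ℚ * c                                       ≡⟨ ℚ.*-identityˡ c ⟩
    c                                            ∎
    where
    open ≡-Reasoning
    k : ℕ
    k = length xs

  mean-+ : ∀ (g : A → ℚ) c x xs → mean (λ y → g y + c) x xs ≡ mean g x xs + c
  mean-+ g c x xs = trans (cong (+ 1 / suc (length xs) *_) (sumℚ-+ (x ∷ xs) g (λ _ → c)))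
    (trans (ℚ.*-distribˡ-+ (+ 1 / suc (length xs)) _ _) (cong (_+_ (mean g x xs)) (mean-const c x xs)))

  mean-fromℕ : ∀ (g : A → ℕ) x xs → mean (fromℕ ∘ g) x xs ≡ + ∑ (x ∷ xs) g / suc (length xs)
  mean-fromℕ g x xs = trans (cong (+ 1 / suc (length xs) *_) (sumℚ-fromℕ (x ∷ xs) g))
    (trans (/-*-fromℕ 1 (length xs) (∑ (x ∷ xs) g)) (ℚ./-cong {+ (1 ℕ.* ∑ (x ∷ xs) g)} {suc (length xs)} (cong +_ (ℕ.*-identityˡ _)) refl))

Comparable : ∀ {n} → Subset n → Subset n → Set
Comparable x y = x ⊆ y ⊎ y ⊆ x

p⊆q∧∣p∣≡∣q∣⇒p≡q : ∀ {n} {p q : Subset n} → p ⊆ q → ∣ p ∣ ≡ ∣ q ∣ → p ≡ q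
p⊆q∧∣p∣≡∣q∣⇒p≡q {p = []}          {[]}          _   _  = refl
p⊆q∧∣p∣≡∣q∣⇒p≡q {p = outside ∷ p} {outside ∷ q} p⊆q eq = cong (outside ∷_) (p⊆q∧∣p∣≡∣q∣⇒p≡q (drop-∷-⊆ p⊆q) eq)
p⊆q∧∣p∣≡∣q∣⇒p≡q {p = outside ∷ p} {inside  ∷ q} p⊆q eq = contradiction eq (ℕ.<⇒≢ (s≤s (p⊆q⇒∣p∣≤∣q∣ (drop-∷-⊆ p⊆q))))
p⊆q∧∣p∣≡∣q∣⇒p≡q {p = inside  ∷ p} {outside ∷ q} p⊆q eq = contradiction (p⊆q here) λ ()
p⊆q∧∣p∣≡∣q∣⇒p≡q {p = inside  ∷ p} {inside  ∷ q} p⊆q eq = cong (inside ∷_) (p⊆q∧∣p∣≡∣q∣⇒p≡q (drop-∷-⊆ p⊆q) (ℕ.suc-injective eq))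

comparable∧≢⇒∣∣≢ : ∀ {n} {x y : Subset n} → Comparable x y → x ≢ y → ∣ x ∣ ≢ ∣ y ∣
comparable∧≢⇒∣∣≢ (inj₁ x⊆y) x≢y eq = x≢y (p⊆q∧∣p∣≡∣q∣⇒p≡q x⊆y eq)
comparable∧≢⇒∣∣≢ (inj₂ y⊆x) x≢y eq = x≢y (sym (p⊆q∧∣p∣≡∣q∣⇒p≡q y⊆x (sym eq)))

Nonempty⇒∣p∣≥1 : ∀ {n} {p : Subset n} → Nonempty p → 1 ℕ.≤ ∣ p ∣
Nonempty⇒∣p∣≥1 (x , x∈p) = subst (ℕ._≤ _) (∣⁅x⁆∣≡1 x) (p⊆q⇒∣p∣≤∣q∣ λ y∈⁅x⁆ → subst (_∈ _) (sym (x∈⁅y⁆⇒x≡y x y∈⁅x⁆)) x∈p)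

∣p∣≥1⇒Nonempty : ∀ {n} {p : Subset n} → 1 ℕ.≤ ∣ p ∣ → Nonempty p
∣p∣≥1⇒Nonempty {n} {p} 1≤∣p∣ with nonempty? p
... | yes ne = ne
... | no ¬ne = contradiction (sym (trans (cong ∣_∣ (Empty-unique ¬ne)) (∣⊥∣≡0 n))) (ℕ.<⇒≢ 1≤∣p∣)

⊆-interpolate : ∀ {n} {a b : Subset n} s → a ⊆ b → ∣ a ∣ ℕ.≤ s → s ℕ.≤ ∣ b ∣ → ∃ λ z → a ⊆ z × z ⊆ b × ∣ z ∣ ≡ s
⊆-interpolate {a = []}          {[]}          s _ ∣a∣≤s s≤∣b∣ = [] , (λ ()) , (λ ()) , ℕ.≤-antisym ∣a∣≤s s≤∣b∣
⊆-interpolate {a = outside ∷ a} {outside ∷ b} s a⊆b ∣a∣≤s s≤∣b∣ with ⊆-interpolate s (drop-∷-⊆ a⊆b) ∣a∣≤s s≤∣b∣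
... | z , a⊆z , z⊆b , ∣z∣≡s = outside ∷ z , s⊆s a⊆z , s⊆s z⊆b , ∣z∣≡s
⊆-interpolate {a = inside  ∷ a} {outside ∷ b} s a⊆b _ _ = contradiction (a⊆b here) λ ()
⊆-interpolate {a = inside  ∷ a} {inside  ∷ b} (suc s) a⊆b (s≤s ∣a∣≤s) (s≤s s≤∣b∣)
  with ⊆-interpolate s (drop-∷-⊆ a⊆b) ∣a∣≤s s≤∣b∣
... | z , a⊆z , z⊆b , ∣z∣≡s = inside ∷ z , s⊆s a⊆z , s⊆s z⊆b , cong suc ∣z∣≡s
⊆-interpolate {a = outside ∷ a} {inside  ∷ b} s a⊆b ∣a∣≤s s≤∣b∣ with ∣ a ∣ ℕ.≟ s
... | yes refl with ⊆-interpolate ∣ a ∣ (drop-∷-⊆ a⊆b) ℕ.≤-refl (p⊆q⇒∣p∣≤∣q∣ (drop-∷-⊆ a⊆b))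
...   | z , a⊆z , z⊆b , ∣z∣≡s = outside ∷ z , s⊆s a⊆z , out⊆ z⊆b , ∣z∣≡s
⊆-interpolate {a = outside ∷ a} {inside  ∷ b} (suc s) a⊆b ∣a∣≤s (s≤s s≤∣b∣) | no ∣a∣≢s
  with ⊆-interpolate s (drop-∷-⊆ a⊆b) (ℕ.<⇒≤pred (ℕ.≤∧≢⇒< ∣a∣≤s ∣a∣≢s)) s≤∣b∣
... | z , a⊆z , z⊆b , ∣z∣≡s = inside ∷ z , out⊆ a⊆z , s⊆s z⊆b , cong suc ∣z∣≡s
⊆-interpolate {a = outside ∷ a} {inside  ∷ b} zero a⊆b ∣a∣≤0 _ | no ∣a∣≢0 = contradiction (ℕ.n≤0⇒n≡0 ∣a∣≤0) ∣a∣≢0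

x∈p─q⇒x∉q : ∀ {n} {p q : Subset n} {x} → x ∈ p ─ q → x ∉ q
x∈p─q⇒x∉q {p = _ ∷ p} {inside ∷ q} ()         here
x∈p─q⇒x∉q {p = _ ∷ p} {_      ∷ q} (there x∈) (there x∈q) = x∈p─q⇒x∉q x∈ x∈q

p-x∪⁅x⁆≡p : ∀ {n} {p : Subset n} {x} → x ∈ p → (p - x) ∪ ⁅ x ⁆ ≡ p
p-x∪⁅x⁆≡p {p = p} {x} x∈p = ⊆-antisym ⊆p ⊇p
  where
  ⊆p : (p - x) ∪ ⁅ x ⁆ ⊆ p
  ⊆p {y} y∈ with x∈p∪q⁻ (p - x) ⁅ x ⁆ y∈
  ... | inj₁ y∈p-x = p─q⊆p p ⁅ x ⁆ y∈p-x
  ... | inj₂ y∈⁅x⁆ = subst (_∈ p) (sym (x∈⁅y⁆⇒x≡y x y∈⁅x⁆)) x∈p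
  ⊇p : p ⊆ (p - x) ∪ ⁅ x ⁆
  ⊇p {y} y∈p with y Fin.≟ x
  ... | yes refl = x∈p∪q⁺ (inj₂ (x∈⁅x⁆ x))
  ... | no  y≢x  = x∈p∪q⁺ (inj₁ (x∈p∧x≢y⇒x∈p-y y∈p y≢x))

p-x-empty⇒p≡⁅x⁆ : ∀ {n} {p : Subset n} {x} → x ∈ p → ¬ Nonempty (p - x) → p ≡ ⁅ x ⁆
p-x-empty⇒p≡⁅x⁆ {p = p} {x} x∈p p-x-empty = ⊆-antisym ⊆⁅x⁆ (λ y∈⁅x⁆ → subst (_∈ p) (sym (x∈⁅y⁆⇒x≡y x y∈⁅x⁆)) x∈p)
  where
  ⊆⁅x⁆ : p ⊆ ⁅ x ⁆
  ⊆⁅x⁆ {y} y∈p with y Fin.≟ x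
  ... | yes refl = x∈⁅x⁆ x
  ... | no  y≢x  = contradiction (y , x∈p∧x≢y⇒x∈p-y y∈p y≢x) p-x-empty

x∪⁅v⁆≡y∪⁅v⁆⇒x⊆y : ∀ {n} {x y : Subset n} {v} → v ∉ x → x ∪ ⁅ v ⁆ ≡ y ∪ ⁅ v ⁆ → x ⊆ y
x∪⁅v⁆≡y∪⁅v⁆⇒x⊆y {x = x} {y} {v} v∉x eq {u} u∈x with x∈p∪q⁻ y ⁅ v ⁆ (subst (u ∈_) eq (x∈p∪q⁺ (inj₁ u∈x)))
... | inj₁ u∈y   = u∈y
... | inj₂ u∈⁅v⁆ = contradiction (subst (_∈ x) (x∈⁅y⁆⇒x≡y v u∈⁅v⁆) u∈x) v∉x

⁅v⁆≢x∪⁅v⁆ : ∀ {n} {x : Subset n} {v} → Nonempty x → v ∉ x → ⁅ v ⁆ ≢ x ∪ ⁅ v ⁆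
⁅v⁆≢x∪⁅v⁆ {x = x} {v} (u , u∈x) v∉x eq =
  v∉x (subst (_∈ x) (x∈⁅y⁆⇒x≡y v (subst (u ∈_) (sym eq) (x∈p∪q⁺ (inj₁ u∈x)))) u∈x)

∑-allFin-suc : ∀ {n} (g : Fin (suc n) → ℕ) → ∑ (allFin (suc n)) g ≡ g Fin.zero ℕ.+ ∑ (allFin n) (g ∘ Fin.suc)
∑-allFin-suc {n} g = cong (g Fin.zero ℕ.+_) (trans (cong (λ vs → ∑ vs g) (sym (map-tabulate id Fin.suc))) (∑-map (allFin n) Fin.suc g))

∣p∣≡∑𝟙∈ : ∀ {n} (p : Subset n) → ∣ p ∣ ≡ ∑ (allFin n) (λ v → 𝟙 (v ∈? p))
∣p∣≡∑𝟙∈ []            = refl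
∣p∣≡∑𝟙∈ (inside  ∷ p) = trans (cong suc (∣p∣≡∑𝟙∈ p)) (sym (∑-allFin-suc (λ v → 𝟙 (v ∈? inside ∷ p))))
∣p∣≡∑𝟙∈ (outside ∷ p) = trans (∣p∣≡∑𝟙∈ p) (sym (∑-allFin-suc (λ v → 𝟙 (v ∈? outside ∷ p))))

-- * The augmented inductive dimension

module _ {n : ℕ} where

  dimF⁺ : ℕ → List (Subset n) → ℚ
  dimF⁺ k H = dimF k H + 1ℚ

  dimF⁺-∷ : ∀ k h hs → dimF⁺ (suc k) (h ∷ hs) ≡ mean (λ x → dimF⁺ k (sphere (h ∷ hs) x) + 1ℚ) h hs
  dimF⁺-∷ k h hs = sym (begin
    mean (λ x → dimF k (S x) + 1ℚ + 1ℚ) h hs ≡⟨ mean-+ (λ x → dimF k (S x) + 1ℚ) 1ℚ h hs ⟩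
    mean (λ x → dimF k (S x) + 1ℚ) h hs + 1ℚ ≡⟨ cong (_+ 1ℚ) (mean-+ (λ x → dimF k (S x)) 1ℚ h hs) ⟩
    mean (λ x → dimF k (S x)) h hs + 1ℚ + 1ℚ ≡⟨ cong (_+ 1ℚ) (ℚ.+-comm (mean (λ x → dimF k (S x)) h hs) 1ℚ) ⟩
    dimF⁺ (suc k) (h ∷ hs)                   ∎)
    where
    open ≡-Reasoning
    S : Subset n → List (Subset n)
    S = sphere (h ∷ hs)

  private
    in-sphere? : (x y : Subset n) → Dec (y ≢ x × Comparable y x)
    in-sphere? x y = ¬? (y ≟S x) ×-dec ((y ⊆? x) ⊎-dec (x ⊆? y))

  ∈-sphere⁻ : ∀ {H x y} → y ∈ₗ sphere H x → y ∈ₗ H × y ≢ x × Comparable y x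
  ∈-sphere⁻ {x = x} = ∈-filter⁻ (in-sphere? x)

  ∈-sphere⁺ : ∀ {H x y} → y ∈ₗ H → y ≢ x → Comparable y x → y ∈ₗ sphere H x
  ∈-sphere⁺ {x = x} y∈H y≢x y~x = ∈-filter⁺ (in-sphere? x) y∈H (y≢x , y~x)

  sphere-unique : ∀ {H} x → Unique H → Unique (sphere H x)
  sphere-unique x = Unique.filter⁺ (in-sphere? x)

  length-sphere-< : ∀ {H x} → x ∈ₗ H → length (sphere H x) ℕ.< length H
  length-sphere-< {H} {x} x∈H = filter-notAll (in-sphere? x) H (Any.map (λ { refl (x≢x , _) → x≢x refl }) x∈H)

_∖_ : List ℕ → ℕ → List ℕ
R ∖ s = filter (λ t → ¬? (t ℕ.≟ s)) R

∈-∖⁺ : ∀ {R s t} → t ∈ₗ R → t ≢ s → t ∈ₗ R ∖ s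
∈-∖⁺ {s = s} = ∈-filter⁺ (λ t → ¬? (t ℕ.≟ s))

∈-∖⁻ : ∀ {R s t} → t ∈ₗ R ∖ s → t ∈ₗ R × t ≢ s
∈-∖⁻ {s = s} = ∈-filter⁻ (λ t → ¬? (t ℕ.≟ s))

∖-unique : ∀ {R} s → Unique R → Unique (R ∖ s)
∖-unique s = Unique.filter⁺ (λ t → ¬? (t ℕ.≟ s))

length-∖-< : ∀ {R s} → s ∈ₗ R → length (R ∖ s) ℕ.< length R
length-∖-< {R} {s} s∈R = filter-notAll (λ t → ¬? (t ℕ.≟ s)) R (Any.map (λ { refl s≢s → s≢s refl }) s∈R)

length-∖-unique : ∀ {R} s → Unique R → length R ℕ.≤ suc (length (R ∖ s))
length-∖-unique {R} s R! = length-mono-⊆ R! R⊆s∷R∖s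
  where
  R⊆s∷R∖s : ∀ {t} → t ∈ₗ R → t ∈ₗ s ∷ R ∖ s
  R⊆s∷R∖s {t} t∈R with t ℕ.≟ s
  ... | yes t≡s = here t≡s
  ... | no  t≢s = there (∈-∖⁺ t∈R t≢s)

[1…_] : ℕ → List ℕ
[1… n ] = applyUpTo suc n

∈-[1…]⁺ : ∀ {n s} → 1 ℕ.≤ s → s ℕ.≤ n → s ∈ₗ [1… n ]
∈-[1…]⁺ {s = suc t} _ t<n = ∈-applyUpTo⁺ suc t<n

∈-[1…]⁻ : ∀ {n s} → s ∈ₗ [1… n ] → 1 ℕ.≤ s × s ℕ.≤ n
∈-[1…]⁻ s∈ with _ , i<n , refl ← ∈-applyUpTo⁻ suc s∈ = s≤s z≤n , i<n

[1…]-unique : ∀ n → Unique [1… n ]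
[1…]-unique n = Unique.applyUpTo⁺₁ suc n (λ i<j _ → ℕ.<⇒≢ (s≤s i<j))

dimF⁺≤#sizes : ∀ {n} k (H : List (Subset n)) R → (∀ {y} → y ∈ₗ H → ∣ y ∣ ∈ₗ R) → dimF⁺ k H ℚ.≤ fromℕ (length R)
dimF⁺≤#sizes zero    _        R _ = fromℕ-mono-≤ {0} {length R} z≤n
dimF⁺≤#sizes (suc k) []       R _ = fromℕ-mono-≤ {0} {length R} z≤n
dimF⁺≤#sizes (suc k) (h ∷ hs) R sizes∈R = begin
  dimF⁺ (suc k) (h ∷ hs)                      ≡⟨ dimF⁺-∷ k h hs ⟩
  mean (λ x → dimF⁺ k (sphere (h ∷ hs) x) + 1ℚ) h hs ≤⟨ mean-mono-≤ h hs term≤ ⟩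
  mean (λ _ → fromℕ (length R)) h hs          ≡⟨ mean-const _ h hs ⟩
  fromℕ (length R)                            ∎
  where
  open ℚ.≤-Reasoning
  term≤ : ∀ {x} → x ∈ₗ h ∷ hs → dimF⁺ k (sphere (h ∷ hs) x) + 1ℚ ℚ.≤ fromℕ (length R)
  term≤ {x} x∈H = begin
    dimF⁺ k (sphere (h ∷ hs) x) + 1ℚ ≤⟨ ℚ.+-monoˡ-≤ 1ℚ (dimF⁺≤#sizes k _ (R ∖ ∣ x ∣) sizes∈R∖∣x∣) ⟩
    fromℕ (length (R ∖ ∣ x ∣)) + 1ℚ  ≡⟨ fromℕ-suc (length (R ∖ ∣ x ∣)) ⟨
    fromℕ (suc (length (R ∖ ∣ x ∣)))  ≤⟨ fromℕ-mono-≤ (length-∖-< (sizes∈R x∈H)) ⟩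
    fromℕ (length R)                  ∎
    where
    sizes∈R∖∣x∣ : ∀ {y} → y ∈ₗ sphere (h ∷ hs) x → ∣ y ∣ ∈ₗ R ∖ ∣ x ∣
    sizes∈R∖∣x∣ y∈S with y∈H , y≢x , y~x ← ∈-sphere⁻ y∈S = ∈-∖⁺ (sizes∈R y∈H) (comparable∧≢⇒∣∣≢ y~x y≢x)

-- * Links of chains in the complete complex

-- IsKn n G is Enumerates G Nonempty.
Enumerates : ∀ {A : Set} → List A → (A → Set) → Set
Enumerates H P = Unique H × (∀ x → (x ∈ₗ H → P x) × (P x → x ∈ₗ H))

module _ {n : ℕ} where

  Chain : List (Subset n) → Set
  Chain = AllPairs Comparable

  InLink : List (Subset n) → Subset n → Set
  InLink C z = Nonempty z × All (λ c → z ≢ c × Comparable z c) C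

  MissingSize : List (Subset n) → ℕ → Set
  MissingSize C s = 1 ℕ.≤ s × s ℕ.≤ n × All (λ c → ∣ c ∣ ≢ s) C

  Anchored : List (Subset n) → Subset n → Set
  Anchored C a = ∀ d → All (Comparable d) C → Comparable d a

  -- A missing size s lies strictly between two consecutive members of the chain (or ⊥ and ⊤), and any set
  -- squeezed between those two is comparable with every member. The anchors let the next member be compared.
  record Bracket (C : List (Subset n)) (s : ℕ) : Set where
    field
      lower upper    : Subset n
      lower⊆upper    : lower ⊆ upper
      ∣lower∣<s      : ∣ lower ∣ ℕ.< s
      s≤∣upper∣      : s ℕ.≤ ∣ upper ∣
      separates      : All (λ c → c ⊆ lower ⊎ upper ⊆ c) C
      lower-anchored : Anchored C lower
      upper-anchored : Anchored C upper

  bracket-[] : ∀ {s} → 1 ℕ.≤ s → s ℕ.≤ n → Bracket [] s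
  bracket-[] {s} 1≤s s≤n = record
    { lower = ⊥ ; upper = ⊤ ; lower⊆upper = ⊆-min ⊤
    ; ∣lower∣<s = subst (ℕ._< s) (sym (∣⊥∣≡0 n)) 1≤s
    ; s≤∣upper∣ = subst (s ℕ.≤_) (sym (∣⊤∣≡n n)) s≤n
    ; separates = []
    ; lower-anchored = λ d _ → inj₂ (⊆-min d)
    ; upper-anchored = λ d _ → inj₁ (⊆-max d)
    }

  bracket-∷ : ∀ {c C s} → All (Comparable c) C → ∣ c ∣ ≢ s → Bracket C s → Bracket (c ∷ C) s
  bracket-∷ {c} {C} {s} c~C ∣c∣≢s b = insert (ℕ.<-cmp ∣ c ∣ s) (lower-anchored c c~C) (upper-anchored c c~C)
    where
    open Bracket b
    keep : (c ⊆ lower ⊎ upper ⊆ c) → Bracket (c ∷ C) s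
    keep c-sep = record
      { lower = lower ; upper = upper ; lower⊆upper = lower⊆upper ; ∣lower∣<s = ∣lower∣<s ; s≤∣upper∣ = s≤∣upper∣
      ; separates = c-sep ∷ separates
      ; lower-anchored = λ d → lower-anchored d ∘ All.tail
      ; upper-anchored = λ d → upper-anchored d ∘ All.tail
      }
    insert : Tri (∣ c ∣ ℕ.< s) (∣ c ∣ ≡ s) (s ℕ.< ∣ c ∣) → Comparable c lower → Comparable c upper → Bracket (c ∷ C) s
    insert (tri≈ _ ∣c∣≡s _) _ _ = contradiction ∣c∣≡s ∣c∣≢s
    insert (tri< _ _ _) (inj₁ c⊆lower) _ = keep (inj₁ c⊆lower)
    insert (tri< ∣c∣<s _ _) (inj₂ lower⊆c) (inj₁ c⊆upper) = record
      { lower = c ; upper = upper ; lower⊆upper = c⊆upper ; ∣lower∣<s = ∣c∣<s ; s≤∣upper∣ = s≤∣upper∣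
      ; separates = inj₁ ⊆-refl ∷ All.map raise-lower separates
      ; lower-anchored = λ d → All.head
      ; upper-anchored = λ d → upper-anchored d ∘ All.tail
      }
      where
      raise-lower : ∀ {d} → d ⊆ lower ⊎ upper ⊆ d → d ⊆ c ⊎ upper ⊆ d
      raise-lower (inj₁ d⊆lower) = inj₁ (⊆-trans d⊆lower lower⊆c)
      raise-lower (inj₂ upper⊆d) = inj₂ upper⊆d
    insert (tri< ∣c∣<s _ _) (inj₂ _) (inj₂ upper⊆c) =
      contradiction (ℕ.≤-<-trans (ℕ.≤-trans s≤∣upper∣ (p⊆q⇒∣p∣≤∣q∣ upper⊆c)) ∣c∣<s) (ℕ.<-irrefl refl)
    insert (tri> _ _ s<∣c∣) (inj₁ c⊆lower) _ =
      contradiction (ℕ.<-trans (ℕ.≤-<-trans (p⊆q⇒∣p∣≤∣q∣ c⊆lower) ∣lower∣<s) s<∣c∣) (ℕ.<-irrefl refl)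
    insert (tri> _ _ s<∣c∣) (inj₂ lower⊆c) (inj₁ c⊆upper) = record
      { lower = lower ; upper = c ; lower⊆upper = lower⊆c ; ∣lower∣<s = ∣lower∣<s ; s≤∣upper∣ = ℕ.<⇒≤ s<∣c∣
      ; separates = inj₂ ⊆-refl ∷ All.map lower-upper separates
      ; lower-anchored = λ d → lower-anchored d ∘ All.tail
      ; upper-anchored = λ d → All.head
      }
      where
      lower-upper : ∀ {d} → d ⊆ lower ⊎ upper ⊆ d → d ⊆ lower ⊎ c ⊆ d
      lower-upper (inj₁ d⊆lower) = inj₁ d⊆lower
      lower-upper (inj₂ upper⊆d) = inj₂ (⊆-trans c⊆upper upper⊆d)
    insert (tri> _ _ _) (inj₂ _) (inj₂ upper⊆c) = keep (inj₂ upper⊆c)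

  bracket : ∀ {C s} → Chain C → MissingSize C s → Bracket C s
  bracket []            (1≤s , s≤n , [])            = bracket-[] 1≤s s≤n
  bracket (c~C ∷ chain) (1≤s , s≤n , ∣c∣≢s ∷ missing) = bracket-∷ c~C ∣c∣≢s (bracket chain (1≤s , s≤n , missing))

  chain-extension : ∀ {C s} → Chain C → MissingSize C s → ∃ λ z → ∣ z ∣ ≡ s × InLink C z
  chain-extension {C} {s} chain missing@(1≤s , _ , ∣C∣≢s) =
    in-link (⊆-interpolate s lower⊆upper (ℕ.<⇒≤ ∣lower∣<s) s≤∣upper∣)
    where
    open Bracket (bracket chain missing)
    in-link : (∃ λ z → lower ⊆ z × z ⊆ upper × ∣ z ∣ ≡ s) → ∃ λ z → ∣ z ∣ ≡ s × InLink C z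
    in-link (z , lower⊆z , z⊆upper , ∣z∣≡s) =
      z , ∣z∣≡s , ∣p∣≥1⇒Nonempty (subst (1 ℕ.≤_) (sym ∣z∣≡s) 1≤s) , All.zipWith strictly (∣C∣≢s , separates)
      where
      strictly : ∀ {c} → ∣ c ∣ ≢ s × (c ⊆ lower ⊎ upper ⊆ c) → z ≢ c × Comparable z c
      strictly (∣c∣≢s , inj₁ c⊆lower) = (λ { refl → ∣c∣≢s ∣z∣≡s }) , inj₂ (⊆-trans c⊆lower lower⊆z)
      strictly (∣c∣≢s , inj₂ upper⊆c) = (λ { refl → ∣c∣≢s ∣z∣≡s }) , inj₁ (⊆-trans z⊆upper upper⊆c)

  sphere-link : ∀ {H C x} → Enumerates H (InLink C) → x ∈ₗ H → Enumerates (sphere H x) (InLink (x ∷ C))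
  sphere-link {H} {C} {x} (H! , H≈link) x∈H = sphere-unique x H! , λ z → into , outof z
    where
    into : ∀ {z} → z ∈ₗ sphere H x → InLink (x ∷ C) z
    into {z} z∈S with z∈H , z≢x , z~x ← ∈-sphere⁻ z∈S with ne , z~C ← proj₁ (H≈link z) z∈H = ne , (z≢x , z~x) ∷ z~C
    outof : ∀ z → InLink (x ∷ C) z → z ∈ₗ sphere H x
    outof z (ne , (z≢x , z~x) ∷ z~C) = ∈-sphere⁺ (proj₂ (H≈link z) (ne , z~C)) z≢x z~x

  empty-link⇒¬MissingSize : ∀ {C s} → Enumerates [] (InLink C) → Chain C → ¬ MissingSize C s
  empty-link⇒¬MissingSize (_ , []≈link) chain missing with z , _ , z∈link ← chain-extension chain missing
    with () ← proj₂ ([]≈link z) z∈link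

  -- The bound length H ≤ k keeps the fuel of dimF from running out.
  #missing≤dimF⁺ : ∀ k {H C} R → Enumerates H (InLink C) → length H ℕ.≤ k → Chain C → Unique R →
                   (∀ {s} → s ∈ₗ R → MissingSize C s) → fromℕ (length R) ℚ.≤ dimF⁺ k H
  #missing≤dimF⁺ zero    {[]} []      _ _ _ _ _ = ℚ.≤-refl
  #missing≤dimF⁺ (suc k) {[]} []      _ _ _ _ _ = ℚ.≤-refl
  #missing≤dimF⁺ k       {[]} (s ∷ R) H≈link _ chain _ missing =
    contradiction (missing (here refl)) (empty-link⇒¬MissingSize H≈link chain)
  #missing≤dimF⁺ (suc k) {h ∷ hs} {C} R H≈link (s≤s ∣H∣≤k) chain R! missing = begin
    fromℕ (length R)                                    ≡⟨ mean-const _ h hs ⟨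
    mean (λ _ → fromℕ (length R)) h hs                  ≤⟨ mean-mono-≤ h hs term≥ ⟩
    mean (λ x → dimF⁺ k (sphere (h ∷ hs) x) + 1ℚ) h hs ≡⟨ dimF⁺-∷ k h hs ⟨
    dimF⁺ (suc k) (h ∷ hs)                              ∎
    where
    open ℚ.≤-Reasoning
    term≥ : ∀ {x} → x ∈ₗ h ∷ hs → fromℕ (length R) ℚ.≤ dimF⁺ k (sphere (h ∷ hs) x) + 1ℚ
    term≥ {x} x∈H = begin
      fromℕ (length R)                 ≤⟨ fromℕ-mono-≤ (length-∖-unique ∣ x ∣ R!) ⟩
      fromℕ (suc (length (R ∖ ∣ x ∣))) ≡⟨ fromℕ-suc (length (R ∖ ∣ x ∣)) ⟩
      fromℕ (length (R ∖ ∣ x ∣)) + 1ℚ  ≤⟨ ℚ.+-monoˡ-≤ 1ℚ (#missing≤dimF⁺ k (R ∖ ∣ x ∣) (sphere-link H≈link x∈H)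
                                             ∣S∣≤k (x~C ∷ chain) (∖-unique ∣ x ∣ R!) missing′) ⟩
      dimF⁺ k (sphere (h ∷ hs) x) + 1ℚ ∎
      where
      ∣S∣≤k : length (sphere (h ∷ hs) x) ℕ.≤ k
      ∣S∣≤k = ℕ.≤-trans (ℕ.<⇒≤pred (length-sphere-< x∈H)) ∣H∣≤k
      x~C : All (Comparable x) C
      x~C = All.map proj₂ (proj₂ (proj₁ (proj₂ H≈link x) x∈H))
      missing′ : ∀ {s} → s ∈ₗ R ∖ ∣ x ∣ → MissingSize (x ∷ C) s
      missing′ s∈R∖∣x∣ with s∈R , s≢∣x∣ ← ∈-∖⁻ s∈R∖∣x∣ with 1≤s , s≤n , ∣C∣≢s ← missing s∈R =
        1≤s , s≤n , ≢-sym s≢∣x∣ ∷ ∣C∣≢s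

-- * The complete complex

allSubsets : ∀ n → List (Subset n)
allSubsets zero    = [] ∷ []
allSubsets (suc n) = map (outside ∷_) (allSubsets n) ++ map (inside ∷_) (allSubsets n)

allSubsets-unique : ∀ n → Unique (allSubsets n)
allSubsets-unique zero    = [] ∷ []
allSubsets-unique (suc n) =
  Unique.++⁺ (Unique.map⁺ Vec.∷-injectiveʳ (allSubsets-unique n)) (Unique.map⁺ Vec.∷-injectiveʳ (allSubsets-unique n)) disjoint
  where
  disjoint : ∀ {x} → ¬ (x ∈ₗ map (outside ∷_) (allSubsets n) × x ∈ₗ map (inside ∷_) (allSubsets n))
  disjoint (x∈outs , x∈ins) with _ , _ , refl ← ∈-map⁻ (outside ∷_) x∈outs with _ , _ , () ← ∈-map⁻ (inside ∷_) x∈ins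

∈-allSubsets : ∀ {n} (x : Subset n) → x ∈ₗ allSubsets n
∈-allSubsets []                      = here refl
∈-allSubsets (outside ∷ x)           = ∈-++⁺ˡ (∈-map⁺ (outside ∷_) (∈-allSubsets x))
∈-allSubsets {suc n} (inside ∷ x)    = ∈-++⁺ʳ (map (outside ∷_) (allSubsets n)) (∈-map⁺ (inside ∷_) (∈-allSubsets x))

length-allSubsets : ∀ n → length (allSubsets n) ≡ 2 ^ n
length-allSubsets zero    = refl
length-allSubsets (suc n) = begin
  length (map (outside ∷_) A ++ map (inside ∷_) A)   ≡⟨ length-++ (map (outside ∷_) A) ⟩
  length (map (outside ∷_) A) ℕ.+ length (map (inside ∷_) A) ≡⟨ cong₂ ℕ._+_ (length-map _ A) (length-map _ A) ⟩
  length A ℕ.+ length A                               ≡⟨ cong (λ m → m ℕ.+ m) (length-allSubsets n) ⟩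
  2 ^ n ℕ.+ 2 ^ n                                     ≡⟨ cong (2 ^ n ℕ.+_) (ℕ.+-identityʳ (2 ^ n)) ⟨
  2 ^ suc n                                           ∎
  where
  open ≡-Reasoning
  A : List (Subset n)
  A = allSubsets n

∑-size-allSubsets : ∀ n → ∑ (allSubsets n) ∣_∣ ℕ.* 2 ≡ n ℕ.* 2 ^ n
∑-size-allSubsets zero    = refl
∑-size-allSubsets (suc n) = begin
  ∑ (map (outside ∷_) A ++ map (inside ∷_) A) ∣_∣ ℕ.* 2  ≡⟨ cong (ℕ._* 2) (∑-++ (map (outside ∷_) A) _ ∣_∣) ⟩
  (∑ (map (outside ∷_) A) ∣_∣ ℕ.+ ∑ (map (inside ∷_) A) ∣_∣) ℕ.* 2
    ≡⟨ cong (ℕ._* 2) (cong₂ ℕ._+_ (∑-map A (outside ∷_) ∣_∣) (∑-map A (inside ∷_) ∣_∣)) ⟩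
  (S ℕ.+ ∑ A (λ x → 1 ℕ.+ ∣ x ∣)) ℕ.* 2                 ≡⟨ cong (λ t → (S ℕ.+ t) ℕ.* 2) (∑-+ A (λ _ → 1) ∣_∣) ⟩
  (S ℕ.+ (∑ A (λ _ → 1) ℕ.+ S)) ℕ.* 2                   ≡⟨ cong (λ t → (S ℕ.+ (t ℕ.+ S)) ℕ.* 2) (trans (∑-1 A) (length-allSubsets n)) ⟩
  (S ℕ.+ (2 ^ n ℕ.+ S)) ℕ.* 2                           ≡⟨ solve 2 (λ s p → (s :+ (p :+ s)) :* con 2 := (s :* con 2) :+ (s :* con 2) :+ p :* con 2) refl S (2 ^ n) ⟩
  S ℕ.* 2 ℕ.+ S ℕ.* 2 ℕ.+ 2 ^ n ℕ.* 2                   ≡⟨ cong (λ t → t ℕ.+ t ℕ.+ 2 ^ n ℕ.* 2) (∑-size-allSubsets n) ⟩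
  n ℕ.* 2 ^ n ℕ.+ n ℕ.* 2 ^ n ℕ.+ 2 ^ n ℕ.* 2           ≡⟨ solve 2 (λ n p → n :* p :+ n :* p :+ p :* con 2 := (con 1 :+ n) :* (con 2 :* p)) refl n (2 ^ n) ⟩
  suc n ℕ.* 2 ^ suc n                                   ∎
  where
  open ≡-Reasoning
  open ℕ-Solver
  A : List (Subset n)
  A = allSubsets n
  S : ℕ
  S = ∑ A ∣_∣

module _ {n : ℕ} {G : List (Subset n)} (G-Kn : IsKn n G) where

  ⊥∷Kn↭allSubsets : ⊥ ∷ G ↭ allSubsets n
  ⊥∷Kn↭allSubsets = ∼bag⇒↭ (unique∧set⇒bag (⊥∉G ∷ proj₁ G-Kn) (allSubsets-unique n) (mk⇔ (λ _ → ∈-allSubsets _) ∈⊥∷G))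
    where
    ⊥∉G : All (⊥ ≢_) G
    ⊥∉G = All.tabulate λ { x∈G refl → ∉⊥ (proj₂ (proj₁ (proj₂ G-Kn ⊥) x∈G)) }
    ∈⊥∷G : ∀ {x} → x ∈ₗ allSubsets n → x ∈ₗ ⊥ ∷ G
    ∈⊥∷G {x} _ with nonempty? x
    ... | yes ne = there (proj₂ (proj₂ G-Kn x) ne)
    ... | no ¬ne = here (Empty-unique ¬ne)

  ∑-size-Kn : ∑ G ∣_∣ ℕ.* 2 ≡ n ℕ.* suc (length G)
  ∑-size-Kn = begin
    ∑ G ∣_∣ ℕ.* 2                   ≡⟨ cong (λ t → (t ℕ.+ ∑ G ∣_∣) ℕ.* 2) (∣⊥∣≡0 n) ⟨
    ∑ (⊥ ∷ G) ∣_∣ ℕ.* 2             ≡⟨ cong (ℕ._* 2) (sum-↭ (↭.map⁺ ∣_∣ ⊥∷Kn↭allSubsets)) ⟩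
    ∑ (allSubsets n) ∣_∣ ℕ.* 2      ≡⟨ ∑-size-allSubsets n ⟩
    n ℕ.* 2 ^ n                     ≡⟨ cong (n ℕ.*_) (trans (↭.↭-length ⊥∷Kn↭allSubsets) (length-allSubsets n)) ⟨
    n ℕ.* suc (length G)            ∎
    where open ≡-Reasoning

  Dim⁺-Kn : Dim⁺ G ≡ + n / 2
  Dim⁺-Kn = /-cross-≡ {∑ G ∣_∣} {length G} {n} {1} ∑-size-Kn

  dim⁺-Kn : dim⁺ G ≡ fromℕ n
  dim⁺-Kn = ℚ.≤-antisym
    (subst (λ m → dim⁺ G ℚ.≤ fromℕ m) (length-applyUpTo suc n)
      (dimF⁺≤#sizes (length G) G [1… n ] (λ {y} y∈G → ∈-[1…]⁺ (Nonempty⇒∣p∣≥1 (proj₁ (proj₂ G-Kn y) y∈G)) (∣p∣≤n y))))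
    (subst (λ m → fromℕ m ℚ.≤ dim⁺ G) (length-applyUpTo suc n)
      (#missing≤dimF⁺ (length G) [1… n ] G≈link ℕ.≤-refl [] ([1…]-unique n) (λ s∈ → let 1≤s , s≤n = ∈-[1…]⁻ s∈ in 1≤s , s≤n , [])))
    where
    G≈link : Enumerates G (InLink [])
    G≈link = proj₁ G-Kn , λ x → (λ x∈G → proj₁ (proj₂ G-Kn x) x∈G , []) , (λ (ne , _) → proj₂ (proj₂ G-Kn x) ne)

  Dim⁺≡dim⁺*½-Kn : Dim⁺ G ≡ dim⁺ G * ½
  Dim⁺≡dim⁺*½-Kn = trans Dim⁺-Kn (trans (sym (fromℕ*½ n)) (cong (_* ½) (sym dim⁺-Kn)))

-- * The per-vertex inequality

-- A vertex lies in N = 1 + a + p faces and misses b = a + q, of which a extend by it; the slack below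
-- vanishes exactly when p = q = 0.
vertex-slack : ∀ a p q → let N = suc a ℕ.+ p; m = N ℕ.+ (a ℕ.+ q) in
               (N ℕ.+ a) ℕ.* suc m ℕ.+ (q ℕ.+ p ℕ.* (2 ℕ.* a ℕ.+ 1 ℕ.+ p) ℕ.+ p ℕ.* q) ≡ N ℕ.* 2 ℕ.* m
vertex-slack = solve 3 (λ a p q →
  (con 1 :+ a :+ p :+ a) :* (con 1 :+ ((con 1 :+ a :+ p) :+ (a :+ q))) :+ (q :+ p :* (con 2 :* a :+ con 1 :+ p) :+ p :* q)
  := (con 1 :+ a :+ p) :* con 2 :* ((con 1 :+ a :+ p) :+ (a :+ q))) refl
  where open ℕ-Solver

vertex-≤ : ∀ {N a b m} → N ℕ.+ b ≡ m → a ℕ.≤ b → (N ≡ 0 × a ≡ 0) ⊎ a ℕ.< N → (N ℕ.+ a) ℕ.* suc m ℕ.≤ N ℕ.* 2 ℕ.* m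
vertex-≤ _ _ (inj₁ (refl , refl)) = z≤n
vertex-≤ {a = a} eq a≤b (inj₂ a<N)
  with p , refl ← ℕ.m≤n⇒∃[o]m+o≡n a<N | q , refl ← ℕ.m≤n⇒∃[o]m+o≡n a≤b | refl ← eq =
  ℕ.m+n≤o⇒m≤o _ (ℕ.≤-reflexive (vertex-slack a p q))

vertex-≡ : ∀ {N a b m} → N ℕ.+ b ≡ m → a ℕ.≤ b → (N ≡ 0 × a ≡ 0) ⊎ a ℕ.< N →
           (N ℕ.+ a) ℕ.* suc m ≡ N ℕ.* 2 ℕ.* m → N ≡ 0 ⊎ a ≡ b
vertex-≡ _ _ (inj₁ (refl , _)) _ = inj₁ refl
vertex-≡ {a = a} eq a≤b (inj₂ a<N) tight
  with p , refl ← ℕ.m≤n⇒∃[o]m+o≡n a<N | q , refl ← ℕ.m≤n⇒∃[o]m+o≡n a≤b | refl ← eq =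
  inj₂ (sym (trans (cong (a ℕ.+_) q≡0) (ℕ.+-identityʳ a)))
  where
  slack≡0 : q ℕ.+ p ℕ.* (2 ℕ.* a ℕ.+ 1 ℕ.+ p) ℕ.+ p ℕ.* q ≡ 0
  slack≡0 = ℕ.+-cancelˡ-≡ _ _ 0 (trans (vertex-slack a p q) (trans (sym tight) (sym (ℕ.+-identityʳ _))))
  q≡0 : q ≡ 0
  q≡0 = ℕ.m+n≡0⇒m≡0 q (ℕ.m+n≡0⇒m≡0 _ slack≡0)

-- * Complexes with Dim⁺ = dim⁺ / 2

module _ {n : ℕ} {G : List (Subset n)} (G-complex : IsComplex G) where
  open IsComplex G-complex

  _∈G? : ∀ x → Dec (x ∈ₗ G)
  x ∈G? = DecMembership._∈?_ _≟S_ x G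

  Extendable : Fin n → Subset n → Set
  Extendable v x = v ∉ x × x ∪ ⁅ v ⁆ ∈ₗ G

  extendable? : ∀ v x → Dec (Extendable v x)
  extendable? v x = ¬? (v ∈? x) ×-dec ((x ∪ ⁅ v ⁆) ∈G?)

  deg : Subset n → ℕ
  deg x = ∑ (allFin n) (λ v → 𝟙 (extendable? v x))

  #with #without #extendable : Fin n → ℕ
  #with       v = ∑ G (λ x → 𝟙 (v ∈? x))
  #without    v = ∑ G (λ x → 𝟙 (¬? (v ∈? x)))
  #extendable v = ∑ G (λ x → 𝟙 (extendable? v x))

  singleton-face : ∀ {y v} → y ∈ₗ G → v ∈ y → ⁅ v ⁆ ∈ₗ G
  singleton-face {y} {v} y∈G v∈y = closed y∈G (v , x∈⁅x⁆ v) (λ u∈⁅v⁆ → subst (_∈ y) (sym (x∈⁅y⁆⇒x≡y v u∈⁅v⁆)) v∈y)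

  ∪⁅⁆-face : ∀ {x y v} → y ∈ₗ G → x ⊆ y → v ∈ y → x ∪ ⁅ v ⁆ ∈ₗ G
  ∪⁅⁆-face {x} {y} {v} y∈G x⊆y v∈y = closed y∈G (v , x∈p∪q⁺ (inj₂ (x∈⁅x⁆ v))) x∪⁅v⁆⊆y
    where
    x∪⁅v⁆⊆y : x ∪ ⁅ v ⁆ ⊆ y
    x∪⁅v⁆⊆y {u} u∈ with x∈p∪q⁻ x ⁅ v ⁆ u∈
    ... | inj₁ u∈x   = x⊆y u∈x
    ... | inj₂ u∈⁅v⁆ = subst (_∈ y) (sym (x∈⁅y⁆⇒x≡y v u∈⁅v⁆)) v∈y

  face-size≤size+deg : ∀ {x y} → y ∈ₗ G → x ⊆ y → ∣ y ∣ ℕ.≤ ∣ x ∣ ℕ.+ deg x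
  face-size≤size+deg {x} {y} y∈G x⊆y = begin
    ∣ y ∣                                                          ≡⟨ ∣p∣≡∑𝟙∈ y ⟩
    ∑ (allFin n) (λ v → 𝟙 (v ∈? y))                                ≤⟨ ∑-mono-≤ (allFin n) (λ {v} _ → pointwise v) ⟩
    ∑ (allFin n) (λ v → 𝟙 (v ∈? x) ℕ.+ 𝟙 (extendable? v x))        ≡⟨ ∑-+ (allFin n) _ _ ⟩
    ∑ (allFin n) (λ v → 𝟙 (v ∈? x)) ℕ.+ deg x                      ≡⟨ cong (ℕ._+ deg x) (∣p∣≡∑𝟙∈ x) ⟨
    ∣ x ∣ ℕ.+ deg x                                                ∎
    where
    open ℕ.≤-Reasoning
    pointwise : ∀ v → 𝟙 (v ∈? y) ℕ.≤ 𝟙 (v ∈? x) ℕ.+ 𝟙 (extendable? v x)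
    pointwise v with v ∈? y | v ∈? x | (x ∪ ⁅ v ⁆) ∈G?
    ... | no  _   | _     | _          = z≤n
    ... | yes _   | yes _ | _          = s≤s z≤n
    ... | yes _   | no  _ | yes _      = s≤s z≤n
    ... | yes v∈y | no  _ | no  x∪v∉G = contradiction (∪⁅⁆-face y∈G x⊆y v∈y) x∪v∉G

  sphere-dim≤size+deg : ∀ k {x} → x ∈ₗ G → dimF⁺ k (sphere G x) + 1ℚ ℚ.≤ fromℕ (∣ x ∣ ℕ.+ deg x)
  sphere-dim≤size+deg k {x} x∈G = begin
    dimF⁺ k (sphere G x) + 1ℚ    ≤⟨ ℚ.+-monoˡ-≤ 1ℚ (dimF⁺≤#sizes k (sphere G x) R sizes∈R) ⟩
    fromℕ (length R) + 1ℚ        ≡⟨ fromℕ-suc (length R) ⟨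
    fromℕ (suc (length R))       ≤⟨ fromℕ-mono-≤ (subst (suc (length R) ℕ.≤_) (length-applyUpTo suc t) (length-∖-< ∣x∣∈[1…t])) ⟩
    fromℕ t                      ∎
    where
    open ℚ.≤-Reasoning
    t : ℕ
    t = ∣ x ∣ ℕ.+ deg x
    R : List ℕ
    R = [1… t ] ∖ ∣ x ∣
    ∣x∣∈[1…t] : ∣ x ∣ ∈ₗ [1… t ]
    ∣x∣∈[1…t] = ∈-[1…]⁺ (Nonempty⇒∣p∣≥1 (nonempty x∈G)) (ℕ.m≤m+n ∣ x ∣ (deg x))
    size≤t : ∀ {y} → y ∈ₗ G → Comparable y x → ∣ y ∣ ℕ.≤ t
    size≤t _   (inj₁ y⊆x) = ℕ.≤-trans (p⊆q⇒∣p∣≤∣q∣ y⊆x) (ℕ.m≤m+n ∣ x ∣ (deg x))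
    size≤t y∈G (inj₂ x⊆y) = face-size≤size+deg y∈G x⊆y
    sizes∈R : ∀ {y} → y ∈ₗ sphere G x → ∣ y ∣ ∈ₗ R
    sizes∈R y∈S with y∈G , y≢x , y~x ← ∈-sphere⁻ y∈S =
      ∈-∖⁺ (∈-[1…]⁺ (Nonempty⇒∣p∣≥1 (nonempty y∈G)) (size≤t y∈G y~x)) (comparable∧≢⇒∣∣≢ y~x y≢x)

  #with+#without≡length : ∀ v → #with v ℕ.+ #without v ≡ length G
  #with+#without≡length v = begin
    #with v ℕ.+ #without v                            ≡⟨ ∑-+ G _ _ ⟨
    ∑ G (λ x → 𝟙 (v ∈? x) ℕ.+ 𝟙 (¬? (v ∈? x)))        ≡⟨ ∑-cong G (λ x → excluded-middle (v ∈? x)) ⟩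
    ∑ G (λ _ → 1)                                     ≡⟨ ∑-1 G ⟩
    length G                                          ∎
    where
    open ≡-Reasoning
    excluded-middle : ∀ {P : Set} (P? : Dec P) → 𝟙 P? ℕ.+ 𝟙 (¬? P?) ≡ 1
    excluded-middle (yes _) = refl
    excluded-middle (no  _) = refl

  private
    𝟙extendable≤𝟙∉ : ∀ v x → 𝟙 (extendable? v x) ℕ.≤ 𝟙 (¬? (v ∈? x))
    𝟙extendable≤𝟙∉ v x with v ∈? x | (x ∪ ⁅ v ⁆) ∈G?
    ... | yes _ | _     = z≤n
    ... | no  _ | yes _ = s≤s z≤n
    ... | no  _ | no  _ = z≤n

  #extendable≤#without : ∀ v → #extendable v ℕ.≤ #without v
  #extendable≤#without v = ∑-mono-≤ G (λ {x} _ → 𝟙extendable≤𝟙∉ v x)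

  #extendable≡#without⇒extension-closed : ∀ {v x} → #extendable v ≡ #without v → x ∈ₗ G → v ∉ x → x ∪ ⁅ v ⁆ ∈ₗ G
  #extendable≡#without⇒extension-closed {v} {x} eq x∈G v∉x
    with v ∈? x | (x ∪ ⁅ v ⁆) ∈G? | ∑-mono-≤-equality G (λ {y} _ → 𝟙extendable≤𝟙∉ v y) (ℕ.≤-reflexive (sym eq)) x∈G
  ... | yes v∈x | _         | _ = contradiction v∈x v∉x
  ... | no  _   | yes x∪v∈G | _ = x∪v∈G
  ... | no  _   | no  _     | ()

  vertex⇒#with≥1 : ∀ {v} → IsVertex G v → 1 ℕ.≤ #with v
  vertex⇒#with≥1 {v} (y , y∈G , v∈y) = ℕ.≤-trans (𝟙yes (v ∈? y)) (∑-≥-term G (λ x → 𝟙 (v ∈? x)) y∈G)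
    where
    𝟙yes : (v∈?y : Dec (v ∈ y)) → 1 ℕ.≤ 𝟙 v∈?y
    𝟙yes (yes _)   = s≤s z≤n
    𝟙yes (no v∉y) = contradiction v∈y v∉y

  -- x ↦ x ∪ ⁅ v ⁆ maps the faces extendable by v injectively to the faces other than ⁅ v ⁆ containing v.
  #extendable<#with : ∀ v → (#with v ≡ 0 × #extendable v ≡ 0) ⊎ #extendable v ℕ.< #with v
  #extendable<#with v with ⁅ v ⁆ ∈G?
  ... | no ⁅v⁆∉G = inj₁ (∑-zero G _ no-face-with-v , ∑-zero G _ no-face-extendable)
    where
    no-face-with-v : ∀ {x} → x ∈ₗ G → 𝟙 (v ∈? x) ≡ 0
    no-face-with-v {x} x∈G with v ∈? x
    ... | yes v∈x = contradiction (singleton-face x∈G v∈x) ⁅v⁆∉G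
    ... | no  _   = refl
    no-face-extendable : ∀ {x} → x ∈ₗ G → 𝟙 (extendable? v x) ≡ 0
    no-face-extendable {x} _ with v ∈? x | (x ∪ ⁅ v ⁆) ∈G?
    ... | yes _ | _         = refl
    ... | no  _ | no  _     = refl
    ... | no  _ | yes x∪v∈G = contradiction (singleton-face x∪v∈G (x∈p∪q⁺ (inj₂ (x∈⁅x⁆ v)))) ⁅v⁆∉G
  ... | yes ⁅v⁆∈G = inj₂ (begin
    suc (#extendable v)        ≡⟨ cong suc (∑-𝟙 (extendable? v) G) ⟩
    suc (length E)             ≡⟨ cong suc (length-map (_∪ ⁅ v ⁆) E) ⟨
    length images              ≤⟨ length-mono-⊆ images! images⊆ ⟩
    length (filter (v ∈?_) G)  ≡⟨ ∑-𝟙 (v ∈?_) G ⟨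
    #with v                    ∎)
    where
    open ℕ.≤-Reasoning
    E : List (Subset n)
    E = filter (extendable? v) G
    images : List (Subset n)
    images = ⁅ v ⁆ ∷ map (_∪ ⁅ v ⁆) E
    images! : Unique images
    images! = All.tabulate ⁅v⁆≢image ∷ map⁺-injectiveOn ∪⁅v⁆-injective (Unique.filter⁺ (extendable? v) unique)
      where
      ∪⁅v⁆-injective : ∀ {x y} → x ∈ₗ E → y ∈ₗ E → x ∪ ⁅ v ⁆ ≡ y ∪ ⁅ v ⁆ → x ≡ y
      ∪⁅v⁆-injective x∈E y∈E eq with _ , v∉x , _ ← ∈-filter⁻ (extendable? v) {xs = G} x∈E
                                 with _ , v∉y , _ ← ∈-filter⁻ (extendable? v) {xs = G} y∈E =
        ⊆-antisym (x∪⁅v⁆≡y∪⁅v⁆⇒x⊆y v∉x eq) (x∪⁅v⁆≡y∪⁅v⁆⇒x⊆y v∉y (sym eq))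
      ⁅v⁆≢image : ∀ {z} → z ∈ₗ map (_∪ ⁅ v ⁆) E → ⁅ v ⁆ ≢ z
      ⁅v⁆≢image z∈ with x , x∈E , refl ← ∈-map⁻ (_∪ ⁅ v ⁆) z∈ with x∈G , v∉x , _ ← ∈-filter⁻ (extendable? v) {xs = G} x∈E =
        ⁅v⁆≢x∪⁅v⁆ (nonempty x∈G) v∉x
    images⊆ : ∀ {z} → z ∈ₗ images → z ∈ₗ filter (v ∈?_) G
    images⊆ (here refl) = ∈-filter⁺ (v ∈?_) ⁅v⁆∈G (x∈⁅x⁆ v)
    images⊆ (there z∈) with x , x∈E , refl ← ∈-map⁻ (_∪ ⁅ v ⁆) z∈ with _ , _ , x∪v∈G ← ∈-filter⁻ (extendable? v) {xs = G} x∈E =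
      ∈-filter⁺ (v ∈?_) x∪v∈G (x∈p∪q⁺ (inj₂ (x∈⁅x⁆ v)))

  ∑-size≡∑-#with : ∑ G ∣_∣ ≡ ∑ (allFin n) #with
  ∑-size≡∑-#with = trans (∑-cong G ∣p∣≡∑𝟙∈) (∑-comm G (allFin n) (λ x v → 𝟙 (v ∈? x)))

  ∑-deg≡∑-#extendable : ∑ G deg ≡ ∑ (allFin n) #extendable
  ∑-deg≡∑-#extendable = ∑-comm G (allFin n) (λ x v → 𝟙 (extendable? v x))

  extension-closed⇒complete : (∀ {i x} → IsVertex G i → x ∈ₗ G → i ∉ x → x ∪ ⁅ i ⁆ ∈ₗ G) → IsCompleteOnVertices G
  extension-closed⇒complete extend x ne vertices = build ∣ x ∣ x ℕ.≤-refl ne vertices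
    where
    build : ∀ k x → ∣ x ∣ ℕ.≤ k → Nonempty x → (∀ i → i ∈ x → IsVertex G i) → x ∈ₗ G
    build zero    x ∣x∣≤0   ne _ = contradiction (ℕ.≤-trans (Nonempty⇒∣p∣≥1 ne) ∣x∣≤0) λ ()
    build (suc k) x ∣x∣≤1+k (i , i∈x) vertices with nonempty? (x - i)
    ... | no x-i-empty with _ , y∈G , i∈y ← vertices i i∈x =
      subst (_∈ₗ G) (sym (p-x-empty⇒p≡⁅x⁆ i∈x x-i-empty)) (singleton-face y∈G i∈y)
    ... | yes x-i-nonempty = subst (_∈ₗ G) (p-x∪⁅x⁆≡p i∈x) (extend (vertices i i∈x) x-i∈G (λ i∈x-i → x∈p─q⇒x∉q i∈x-i (x∈⁅x⁆ i)))
      where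
      x-i∈G : x - i ∈ₗ G
      x-i∈G = build k (x - i) (ℕ.<⇒≤pred (ℕ.<-≤-trans (x∈p⇒∣p-x∣<∣p∣ i∈x) ∣x∣≤1+k)) x-i-nonempty
                (λ j j∈x-i → vertices j (p─q⊆p x ⁅ i ⁆ j∈x-i))

  vertex-balance : ∑ G ∣_∣ ℕ.* 2 ℕ.* length G ℕ.≤ ∑ G (λ x → ∣ x ∣ ℕ.+ deg x) ℕ.* suc (length G) →
                   ∀ v → (#with v ℕ.+ #extendable v) ℕ.* suc (length G) ≡ #with v ℕ.* 2 ℕ.* length G
  vertex-balance global v = ∑-mono-≤-equality (allFin n) (λ {v} _ → per-vertex v) summed (∈-allFin v)
    where
    m : ℕ
    m = length G
    per-vertex : ∀ v → (#with v ℕ.+ #extendable v) ℕ.* suc m ℕ.≤ #with v ℕ.* 2 ℕ.* m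
    per-vertex v = vertex-≤ (#with+#without≡length v) (#extendable≤#without v) (#extendable<#with v)
    summed : ∑ (allFin n) (λ v → #with v ℕ.* 2 ℕ.* m) ℕ.≤ ∑ (allFin n) (λ v → (#with v ℕ.+ #extendable v) ℕ.* suc m)
    summed = begin
      ∑ (allFin n) (λ v → #with v ℕ.* 2 ℕ.* m)                 ≡⟨ ∑-*ʳ (allFin n) (λ v → #with v ℕ.* 2) m ⟩
      ∑ (allFin n) (λ v → #with v ℕ.* 2) ℕ.* m                 ≡⟨ cong (ℕ._* m) (∑-*ʳ (allFin n) #with 2) ⟩
      ∑ (allFin n) #with ℕ.* 2 ℕ.* m                           ≡⟨ cong (λ t → t ℕ.* 2 ℕ.* m) ∑-size≡∑-#with ⟨
      ∑ G ∣_∣ ℕ.* 2 ℕ.* m                                      ≤⟨ global ⟩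
      ∑ G (λ x → ∣ x ∣ ℕ.+ deg x) ℕ.* suc m                    ≡⟨ cong (ℕ._* suc m) (∑-+ G ∣_∣ deg) ⟩
      (∑ G ∣_∣ ℕ.+ ∑ G deg) ℕ.* suc m                          ≡⟨ cong₂ (λ s t → (s ℕ.+ t) ℕ.* suc m) ∑-size≡∑-#with ∑-deg≡∑-#extendable ⟩
      (∑ (allFin n) #with ℕ.+ ∑ (allFin n) #extendable) ℕ.* suc m ≡⟨ cong (ℕ._* suc m) (∑-+ (allFin n) #with #extendable) ⟨
      ∑ (allFin n) (λ v → #with v ℕ.+ #extendable v) ℕ.* suc m ≡⟨ ∑-*ʳ (allFin n) (λ v → #with v ℕ.+ #extendable v) (suc m) ⟨
      ∑ (allFin n) (λ v → (#with v ℕ.+ #extendable v) ℕ.* suc m) ∎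
      where open ℕ.≤-Reasoning

  balanced⇒extension-closed : ∑ G ∣_∣ ℕ.* 2 ℕ.* length G ℕ.≤ ∑ G (λ x → ∣ x ∣ ℕ.+ deg x) ℕ.* suc (length G) →
                              ∀ {i x} → IsVertex G i → x ∈ₗ G → i ∉ x → x ∪ ⁅ i ⁆ ∈ₗ G
  balanced⇒extension-closed global {i} i-vertex with
    vertex-≡ (#with+#without≡length i) (#extendable≤#without i) (#extendable<#with i) (vertex-balance global i)
  ... | inj₁ #with≡0 = contradiction (subst (1 ℕ.≤_) #with≡0 (vertex⇒#with≥1 i-vertex)) λ ()
  ... | inj₂ #ext≡#without = #extendable≡#without⇒extension-closed #ext≡#without

dim⁺≤mean-size+deg : ∀ {n} {h : Subset n} {hs} (G-complex : IsComplex (h ∷ hs)) →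
                     dim⁺ (h ∷ hs) ℚ.≤ + ∑ (h ∷ hs) (λ x → ∣ x ∣ ℕ.+ deg G-complex x) / suc (length hs)
dim⁺≤mean-size+deg {h = h} {hs} G-complex = begin
  dim⁺ (h ∷ hs)                                                  ≡⟨ dimF⁺-∷ (length hs) h hs ⟩
  mean (λ x → dimF⁺ (length hs) (sphere (h ∷ hs) x) + 1ℚ) h hs  ≤⟨ mean-mono-≤ h hs (sphere-dim≤size+deg G-complex (length hs)) ⟩
  mean (λ x → fromℕ (∣ x ∣ ℕ.+ deg G-complex x)) h hs            ≡⟨ mean-fromℕ (λ x → ∣ x ∣ ℕ.+ deg G-complex x) h hs ⟩
  + ∑ (h ∷ hs) (λ x → ∣ x ∣ ℕ.+ deg G-complex x) / suc (length hs) ∎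
  where open ℚ.≤-Reasoning

Dim⁺≡dim⁺*½⇒complete : ∀ {n} {G : List (Subset n)} → IsComplex G → Dim⁺ G ≡ dim⁺ G * ½ → IsCompleteOnVertices G
Dim⁺≡dim⁺*½⇒complete {G = []}     _ _ _ (i , i∈x) vertices with _ , () , _ ← vertices i i∈x
Dim⁺≡dim⁺*½⇒complete {G = h ∷ hs} G-complex half =
  extension-closed⇒complete G-complex (balanced⇒extension-closed G-complex balanced)
  where
  balanced : ∑ (h ∷ hs) ∣_∣ ℕ.* 2 ℕ.* length (h ∷ hs) ℕ.≤ ∑ (h ∷ hs) (λ x → ∣ x ∣ ℕ.+ deg G-complex x) ℕ.* suc (length (h ∷ hs))
  balanced = half-/-cross-≤ {∑ (h ∷ hs) ∣_∣} {length (h ∷ hs)} {∑ (h ∷ hs) (λ x → ∣ x ∣ ℕ.+ deg G-complex x)} {length hs}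
               half (dim⁺≤mean-size+deg G-complex)

mainTheorem3 :
    ((n : ℕ) → n ≥ 1 → (G : List (Subset n)) → IsKn n G →
       (Dim⁺ G ≡ + n / 2) × (Dim⁺ G ≡ dim⁺ G * ½))
    × ((n : ℕ) → (G : List (Subset n)) → IsComplex G →
       Dim⁺ G ≡ dim⁺ G * ½ → IsCompleteOnVertices G)
mainTheorem3 = (λ n _ G G-Kn → Dim⁺-Kn G-Kn , Dim⁺≡dim⁺*½-Kn G-Kn) , (λ n G → Dim⁺≡dim⁺*½⇒complete)
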